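{- Let $\mathcal{R}$ be a right-stable DCTRS. Then $\mathbb{U}_{seq}$ is sound for innermost derivations for $\mathcal{R}$: for every original term $u \in \mathcal{T}$ and every term $v$ over the extended signature such that there is an innermost derivation $u \rightarrow^*_{\mathbb{U}_{seq}(\mathcal{R})} v$, we have $u \rightarrow^*_{\mathcal{R}} \mathsf{tb}(v)$ (in particular $u \rightarrow^*_{\mathcal{R}} v$ if $v \in \mathcal{T}$).
   Context: Terms $\mathcal{T}=\mathcal{T}(\mathcal{F},\mathcal{V})$ over a signature $\mathcal{F}$ and a countably infinite set of variables $\mathcal{V}$. An (oriented) conditional rule has the form $l \rightarrow r \Leftarrow s_1 \rightarrow^* t_1, \ldots, s_k \rightarrow^* t_k$ ($k\ge 0$). It is deterministic if $\mathcal{V}ar(r) \subseteq \mathcal{V}ar(l) \cup \mathcal{V}ar(s_1,t_1,\ldots,s_k,t_k)$ and $\mathcal{V}ar(s_i) \subseteq \mathcal{V}ar(l, t_1, \ldots, t_{i-1})$ for all $i$. A DCTRS $\mathcal{R}$ is a set of such rules; $\mathcal{R}_u=\{l\rightarrow r \mid l \rightarrow r \Leftarrow c \in \mathcal{R}\}$. Rewrite relation: $\mathcal{R}_0=\emptyset$, $\mathcal{R}_{n+1}=\{l\sigma \rightarrow r\sigma \mid l \rightarrow r \Leftarrow s_1 \rightarrow^* t_1,\ldots \in \mathcal{R},\ s_j\sigma \rightarrow^*_{\mathcal{R}_n} t_j\sigma \text{ for all } j\}$, $\rightarrow_{\mathcal{R}}=\bigcup_n \rightarrow_{\mathcal{R}_n}$.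 $\mathcal{R}$ is right-stable if for every rule and every $i$, $t_i$ is either a linear constructor term (no root symbol of a left-hand side of $\mathcal{R}$ occurs in it) or a ground term irreducible w.r.t. $\mathcal{R}_u$, and $\mathcal{V}ar(t_i) \cap \mathcal{V}ar(l, s_1, t_1, \ldots, s_{i-1}, t_{i-1}, s_i) = \emptyset$. Sequential unraveling: for $\alpha: l \rightarrow r \Leftarrow s_1 \rightarrow^* t_1, \ldots, s_k \rightarrow^* t_k$ with $k\ge1$, let $X_i=\mathcal{V}ar(l,t_1,\ldots,t_{i-1})$ with fixed ordering $\vec{X_i}$, fresh symbols $U^\alpha_1,\dots,U^\alpha_k$, and $\mathbb{U}_{seq}(\alpha)=\{l \rightarrow U^\alpha_1(s_1,\vec{X_1})\}\cup\{U^\alpha_i(t_i,\vec{X_i}) \rightarrow U^\alpha_{i+1}(s_{i+1},\vec{X_{i+1}}) \mid 1\le i<k\}\cup\{U^\alpha_k(t_k,\vec{X_k}) \rightarrow r\}$; unconditional rules are kept unchanged. $\mathbb{U}_{seq}(\mathcal{R})=\bigcup_{\alpha}\mathbb{U}_{seq}(\alpha)$; terms over the extended signature are mixed terms. Back-translation $\mathsf{tb}$ from mixed terms to $\mathcal{T}$: $\mathsf{tb}(x)=x$; $\mathsf{tb}(f(s_1,\ldots,s_n))=f(\mathsf{tb}(s_1),\ldots,\mathsf{tb}(s_n))$ for $f\in\mathcal{F}$; $\mathsf{tb}(U^\alpha_i(w,v_1,\ldots,v_m))=l\sigma$ where $l$ is the left-hand side of $\alpha$ and $x_j\sigma=\mathsf{tb}(v_j)$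 with $x_1,\ldots,x_m=\vec{X_i}$. A derivation is innermost if each step contracts a redex no proper subterm of which is a redex. -}

module Defs where

open import Data.Nat using (ℕ; zero; suc; _≟_)
open import Data.Fin using (Fin; toℕ)
open import Data.Vec using (Vec; []; _∷_; lookup; _[_]≔_)
open import Data.List using (List; []; _∷_; _++_; length; concat; concatMap; take; deduplicate; map)
open import Data.List.Membership.Propositional using (_∈_)
open import Data.List.Relation.Unary.All using (All)
open import Data.List.Relation.Unary.Unique.Propositional using (Unique)
open import Data.Product using (Σ; Σ-syntax; ∃; _×_; _,_; proj₁; proj₂)
open import Data.Sum using (_⊎_; inj₁; inj₂)
open import Data.Maybe using (Maybe; just; nothing)
open import Data.Empty using (⊥)
open import Relation.Nullary using (¬_; yes; no)
open import Relation.Binary.PropositionalEquality using (_≡_)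
open import Relation.Binary.Construct.Closure.ReflexiveTransitive using (Star)

record Signature : Set₁ where
  field
    Sym : Set
    ar  : Sym → ℕ
open Signature public

data Term (S : Signature) : Set where
  var : ℕ → Term S
  fun : (f : Sym S) → Vec (Term S) (ar S f) → Term S

Rel : Set → Set₁
Rel A = A → A → Set

Subst : Signature → Set
Subst S = ℕ → Term S

mutual
  _⟨_⟩ : ∀ {S} → Term S → Subst S → Term S
  var x ⟨ σ ⟩ = σ x
  fun f ts ⟨ σ ⟩ = fun f (ts ⟨ σ ⟩*)

  _⟨_⟩* : ∀ {S n} → Vec (Term S) n → Subst S → Vec (Term S) n
  [] ⟨ σ ⟩* = []
  (t ∷ ts) ⟨ σ ⟩* = (t ⟨ σ ⟩) ∷ (ts ⟨ σ ⟩*)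

mutual
  vars : ∀ {S} → Term S → List ℕ
  vars (var x) = x ∷ []
  vars (fun f ts) = vars* ts

  vars* : ∀ {S n} → Vec (Term S) n → List ℕ
  vars* [] = []
  vars* (t ∷ ts) = vars t ++ vars* ts

mutual
  funs : ∀ {S} → Term S → List (Sym S)
  funs (var x) = []
  funs (fun f ts) = f ∷ funs* ts

  funs* : ∀ {S n} → Vec (Term S) n → List (Sym S)
  funs* [] = []
  funs* (t ∷ ts) = funs t ++ funs* ts

rootSym : ∀ {S} → Term S → Maybe (Sym S)
rootSym (var x) = nothing
rootSym (fun f ts) = just f

_⊆_ : List ℕ → List ℕ → Set
xs ⊆ ys = ∀ {x} → x ∈ xs → x ∈ ys

Disjoint : List ℕ → List ℕ → Set
Disjoint xs ys = ∀ {x} → x ∈ xs → x ∈ ys → ⊥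

IsVar : ∀ {S} → Term S → Set
IsVar {S} t = Σ ℕ λ x → t ≡ var x

data _⊲_ {S : Signature} (u : Term S) : Term S → Set where
  here   : ∀ {f} (ts : Vec (Term S) (ar S f)) (i : Fin (ar S f)) →
           u ≡ lookup ts i → u ⊲ fun f ts
  deeper : ∀ {f} (ts : Vec (Term S) (ar S f)) (i : Fin (ar S f)) →
           u ⊲ lookup ts i → u ⊲ fun f ts

data Cl {S : Signature} (Root : Rel (Term S)) : Rel (Term S) where
  root : ∀ {s t} → Root s t → Cl Root s t
  arg  : ∀ {f} (ts : Vec (Term S) (ar S f)) (i : Fin (ar S f)) {u} →
         Cl Root (lookup ts i) u → Cl Root (fun f ts) (fun f (ts [ i ]≔ u))

data RootStep {S : Signature} (Rl : Rel (Term S)) : Rel (Term S) where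
  mk : ∀ {l r} (σ : Subst S) → Rl l r → RootStep Rl (l ⟨ σ ⟩) (r ⟨ σ ⟩)

Step : ∀ {S} → Rel (Term S) → Rel (Term S)
Step Rl = Cl (RootStep Rl)

Redex : ∀ {S} → Rel (Term S) → Term S → Set
Redex {S} Rl u = Σ (Term S) λ l → Σ (Term S) λ r → Σ (Subst S) λ σ → Rl l r × u ≡ l ⟨ σ ⟩

data InnerRoot {S : Signature} (Rl : Rel (Term S)) : Rel (Term S) where
  mk : ∀ {l r} (σ : Subst S) → Rl l r →
       (∀ u → u ⊲ (l ⟨ σ ⟩) → ¬ Redex Rl u) →
       InnerRoot Rl (l ⟨ σ ⟩) (r ⟨ σ ⟩)

InnermostStep : ∀ {S} → Rel (Term S) → Rel (Term S)
InnermostStep Rl = Cl (InnerRoot Rl)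

Irreducible : ∀ {S} → Rel (Term S) → Term S → Set
Irreducible {S} Rl t = ∀ (s : Term S) → ¬ Step Rl t s

record CRule (S : Signature) : Set where
  constructor _⇒_⇐_
  field
    lhs   : Term S
    rhs   : Term S
    conds : List (Term S × Term S)
open CRule public

module _ {S : Signature} (α : CRule S) where
  k : ℕ
  k = length (conds α)

  cs : Fin k → Term S
  cs i = proj₁ (Data.List.lookup (conds α) i)

  ct : Fin k → Term S
  ct i = proj₂ (Data.List.lookup (conds α) i)

  varsCondsBefore : Fin k → List ℕ
  varsCondsBefore i = concatMap (λ c → vars (proj₁ c) ++ vars (proj₂ c)) (take (toℕ i) (conds α))

  -- Var(l, t₁, …, t_{i-1}) as a list with repetitions (0-based i)
  varsX : Fin k → List ℕ
  varsX i = vars (lhs α) ++ concatMap (λ c → vars (proj₂ c)) (take (toℕ i) (conds α))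

  -- the fixed ordering  X⃗ᵢ : duplicate-free, order of first occurrence
  Xvec : Fin k → List ℕ
  Xvec i = deduplicate _≟_ (varsX i)

  Deterministic : Set
  Deterministic =
    (vars (rhs α) ⊆ (vars (lhs α) ++ concatMap (λ c → vars (proj₁ c) ++ vars (proj₂ c)) (conds α)))
    × (∀ (i : Fin k) → vars (cs i) ⊆ varsX i)

-- a (possibly infinite) CTRS presented as a family of rules indexed by I
module _ {S : Signature} {I : Set} (R : I → CRule S) where

  Ru : Rel (Term S)
  Ru l r = Σ I λ α → lhs (R α) ≡ l × rhs (R α) ≡ r

  IsDCTRS : Set
  IsDCTRS = ∀ α → ¬ IsVar (lhs (R α)) × Deterministic (R α)

  ConstructorTerm : Term S → Set
  ConstructorTerm t = ∀ {f} → f ∈ funs t → ∀ α → ¬ (rootSym (lhs (R α)) ≡ just f)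

  Linear : Term S → Set
  Linear t = Unique (vars t)

  Ground : Term S → Set
  Ground t = vars t ≡ []

  RightStable : Set
  RightStable = ∀ α (i : Fin (k (R α))) →
    ((Linear (ct (R α) i) × ConstructorTerm (ct (R α) i))
       ⊎ (Ground (ct (R α) i) × Irreducible Ru (ct (R α) i)))
    × Disjoint (vars (ct (R α) i))
               (vars (lhs (R α)) ++ varsCondsBefore (R α) i ++ vars (cs (R α) i))

  data CondRoot (C : Rel (Term S)) : Rel (Term S) where
    mk : ∀ α (σ : Subst S) →
         All (λ c → C (proj₁ c ⟨ σ ⟩) (proj₂ c ⟨ σ ⟩)) (conds (R α)) →
         CondRoot C (lhs (R α) ⟨ σ ⟩) (rhs (R α) ⟨ σ ⟩)

  StepN : ℕ → Rel (Term S)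
  StepN zero = λ _ _ → ⊥
  StepN (suc n) = Cl (CondRoot (Star (StepN n)))

  StepR : Rel (Term S)
  StepR s t = Σ ℕ λ n → StepN n s t

  USym : Set
  USym = Σ I λ α → Fin (k (R α))

  ExtSig : Signature
  ExtSig = record { Sym = Sym S ⊎ USym
                  ; ar  = λ { (inj₁ f) → ar S f
                            ; (inj₂ (α , i)) → suc (length (Xvec (R α) i)) } }

  mutual
    emb : Term S → Term ExtSig
    emb (var x) = var x
    emb (fun f ts) = fun (inj₁ f) (emb* ts)

    emb* : ∀ {n} → Vec (Term S) n → Vec (Term ExtSig) n
    emb* [] = []
    emb* (t ∷ ts) = emb t ∷ emb* ts

  varVec : (xs : List ℕ) → Vec (Term ExtSig) (length xs)
  varVec [] = []
  varVec (x ∷ xs) = var x ∷ varVec xs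

  Uterm : ∀ α (i : Fin (k (R α))) → Term ExtSig → Term ExtSig
  Uterm α i w = fun (inj₂ (α , i)) (w ∷ varVec (Xvec (R α) i))

  -- the rules of U_seq(R)  (U-symbols indexed from 0)
  data Useq : Rel (Term ExtSig) where
    uncond : ∀ α → conds (R α) ≡ [] →
             Useq (emb (lhs (R α))) (emb (rhs (R α)))
    first  : ∀ α (i : Fin (k (R α))) → toℕ i ≡ 0 →
             Useq (emb (lhs (R α))) (Uterm α i (emb (cs (R α) i)))
    middle : ∀ α (i j : Fin (k (R α))) → toℕ j ≡ suc (toℕ i) →
             Useq (Uterm α i (emb (ct (R α) i))) (Uterm α j (emb (cs (R α) j)))
    final  : ∀ α (i : Fin (k (R α))) → suc (toℕ i) ≡ k (R α) →
             Useq (Uterm α i (emb (ct (R α) i))) (emb (rhs (R α)))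

  zipSubst : (xs : List ℕ) → Vec (Term S) (length xs) → Subst S
  zipSubst [] [] y = var y
  zipSubst (x ∷ xs) (t ∷ ts) y with x ≟ y
  ... | yes _ = t
  ... | no _ = zipSubst xs ts y

  mutual
    tb : Term ExtSig → Term S
    tb (var x) = var x
    tb (fun (inj₁ f) ts) = fun f (tb* ts)
    tb (fun (inj₂ (α , i)) (w ∷ vs)) = lhs (R α) ⟨ zipSubst (Xvec (R α) i) (tb* vs) ⟩

    tb* : ∀ {n} → Vec (Term ExtSig) n → Vec (Term S) n
    tb* [] = []
    tb* (t ∷ ts) = tb t ∷ tb* ts

-- A U-term U^α_i(w, v⃗) reachable by innermost U_seq(R)-steps records a partial
-- application of α: with θ the substitution X⃗ᵢ ↦ tb v⃗ (so tb of the U-term is lhs(α)θ),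
-- the conditions before i hold for θ in R and sᵢθ →*_R tb w. This invariant (Valid) is
-- preserved by innermost steps, and under tb every step becomes at most one R-step:
-- entering or advancing a condition leaves tb unchanged, steps inside w only extend the
-- recorded derivation of sᵢθ, and leaving the last condition is an R-step with α whose
-- conditions are exactly the recorded ones. Innermostness keeps the bindings v⃗ redex-free,
-- so they never change under the recorded derivations.

module Submission where

open import Defs
open import Function using (_∘_)
open import Data.Nat using (ℕ; zero; suc; _≤_; _<_; z≤n; s≤s; _⊔_; _≟_)
open import Data.Nat.Properties
  using (m≤m⊔n; m≤n⊔m; ≤-pred; <⇒≤; <-≤-trans; m≤n⇒m<n∨m≡n; n≮0)
open import Data.Fin using (Fin; toℕ) renaming (zero to fzero; suc to fsuc)
import Data.Fin as Fin
open import Data.Fin.Properties using (toℕ<n; toℕ-injective; ¬Fin0)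
open import Data.Vec using (Vec; []; _∷_; lookup; _[_]≔_)
open import Data.Vec.Properties
  using ([]≔-lookup; []≔-idempotent; lookup∘update; lookup∘update′)
open import Data.List as List using (List; []; _∷_; _++_; length; concatMap; take)
open import Data.List.Membership.Propositional using (_∈_)
open import Data.List.Membership.Propositional.Properties
  using (∈-++⁻; ∈-++⁺ˡ; ∈-++⁺ʳ; ∈-deduplicate⁻; ∈-deduplicate⁺; ∈-lookup;
         ∈-concatMap⁻)
open import Data.List.Relation.Unary.Any using (here; there; index)
open import Data.List.Relation.Unary.Any.Properties using (lookup-index)
open import Data.List.Relation.Unary.All using (All; []; _∷_)
import Data.List.Relation.Unary.All as All
open import Data.Product using (Σ; _×_; _,_; proj₁; proj₂)
open import Data.Sum using (_⊎_; inj₁; inj₂)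
open import Data.Empty using (⊥-elim)
open import Relation.Nullary using (¬_; yes; no)
open import Relation.Binary.PropositionalEquality
open import Relation.Binary.Construct.Closure.ReflexiveTransitive using (Star; ε; _◅_; _◅◅_; gmap)
import Relation.Binary.Construct.Closure.ReflexiveTransitive as Star
open import Relation.Binary.Construct.Closure.ReflexiveTransitive.Properties using (reflexive)

module _ {T : Signature} where

  lookup-⟨⟩* : ∀ {n} (ts : Vec (Term T) n) (σ : Subst T) j →
              lookup (ts ⟨ σ ⟩*) j ≡ lookup ts j ⟨ σ ⟩
  lookup-⟨⟩* (t ∷ ts) σ fzero = refl
  lookup-⟨⟩* (t ∷ ts) σ (fsuc j) = lookup-⟨⟩* ts σ j

  _⊴_ : Term T → Term T → Set
  u ⊴ t = u ≡ t ⊎ u ⊲ t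

  ⊲-trans : ∀ {u v w : Term T} → u ⊲ v → v ⊲ w → u ⊲ w
  ⊲-trans p (here ts i refl) = deeper ts i p
  ⊲-trans p (deeper ts i q) = deeper ts i (⊲-trans p q)

  ⊴-⊲-trans : ∀ {u v w : Term T} → u ⊴ v → v ⊲ w → u ⊲ w
  ⊴-⊲-trans (inj₁ refl) q = q
  ⊴-⊲-trans (inj₂ p) q = ⊲-trans p q

  ⊴-trans : ∀ {u v w : Term T} → u ⊴ v → v ⊴ w → u ⊴ w
  ⊴-trans p (inj₁ refl) = p
  ⊴-trans p (inj₂ q) = inj₂ (⊴-⊲-trans p q)

  mutual
    var-⊴-⟨⟩ : ∀ (t : Term T) σ {x} → x ∈ vars t → σ x ⊴ (t ⟨ σ ⟩)
    var-⊴-⟨⟩ (var y) σ (here refl) = inj₁ refl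
    var-⊴-⟨⟩ (fun f ts) σ p with var-⊴-⟨⟩* ts σ p
    ... | j , q = inj₂ (⊴-⊲-trans q (here (ts ⟨ σ ⟩*) j refl))

    var-⊴-⟨⟩* : ∀ {n} (ts : Vec (Term T) n) σ {x} → x ∈ vars* ts →
                Σ (Fin n) λ j → σ x ⊴ lookup (ts ⟨ σ ⟩*) j
    var-⊴-⟨⟩* (t ∷ ts) σ p with ∈-++⁻ (vars t) p
    ... | inj₁ q = fzero , var-⊴-⟨⟩ t σ q
    ... | inj₂ q with var-⊴-⟨⟩* ts σ q
    ...   | j , r = fsuc j , r

  mutual
    ⟨⟩-cong : ∀ (t : Term T) {σ τ : Subst T} →
              (∀ {x} → x ∈ vars t → σ x ≡ τ x) → t ⟨ σ ⟩ ≡ t ⟨ τ ⟩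
    ⟨⟩-cong (var x) h = h (here refl)
    ⟨⟩-cong (fun f ts) h = cong (fun f) (⟨⟩*-cong ts h)

    ⟨⟩*-cong : ∀ {n} (ts : Vec (Term T) n) {σ τ : Subst T} →
               (∀ {x} → x ∈ vars* ts → σ x ≡ τ x) → ts ⟨ σ ⟩* ≡ ts ⟨ τ ⟩*
    ⟨⟩*-cong [] h = refl
    ⟨⟩*-cong (t ∷ ts) h =
      cong₂ _∷_ (⟨⟩-cong t (h ∘ ∈-++⁺ˡ)) (⟨⟩*-cong ts (h ∘ ∈-++⁺ʳ (vars t)))

  RedexFree : Rel (Term T) → Term T → Set
  RedexFree Rl t = ∀ u → u ⊴ t → ¬ Redex Rl u

  RedexFree⇒¬InnermostStep : ∀ {Rl : Rel (Term T)} {t t′} →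
                             RedexFree Rl t → ¬ InnermostStep Rl t t′
  RedexFree⇒¬InnermostStep free (root (mk σ r _)) = free _ (inj₁ refl) (_ , _ , σ , r , refl)
  RedexFree⇒¬InnermostStep free (arg ts i st) =
    RedexFree⇒¬InnermostStep (λ u p → free u (inj₂ (⊴-⊲-trans p (here ts i refl)))) st

  ProperSubtermsRedexFree : Rel (Term T) → Term T → Set
  ProperSubtermsRedexFree Rl t = ∀ u → u ⊲ t → ¬ Redex Rl u

  bindings-redexFree : ∀ {Rl : Rel (Term T)} (t : Term T) σ → ¬ IsVar t →
    ProperSubtermsRedexFree Rl (t ⟨ σ ⟩) → ∀ {x} → x ∈ vars t → RedexFree Rl (σ x)
  bindings-redexFree (var y) σ nonvar _ _ = ⊥-elim (nonvar (y , refl))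
  bindings-redexFree (fun f ts) σ _ inner x∈t u u⊴σx
    with var-⊴-⟨⟩* ts σ x∈t
  ... | j , σx⊴tⱼ = inner u (⊴-⊲-trans (⊴-trans u⊴σx σx⊴tⱼ) (here _ j refl))

  Cl-map : ∀ {A B : Rel (Term T)} → (∀ {s t} → A s t → B s t) →
           ∀ {s t} → Cl A s t → Cl B s t
  Cl-map g (root x) = root (g x)
  Cl-map g (arg ts i c) = arg ts i (Cl-map g c)

  ArgCompatible : Rel (Term T) → Set
  ArgCompatible Q = ∀ {f} (ts : Vec (Term T) (ar T f)) i {u} →
                    Q (lookup ts i) u → Q (fun f ts) (fun f (ts [ i ]≔ u))

  Star-argCompatible : ∀ {Q : Rel (Term T)} → ArgCompatible Q → ArgCompatible (Star Q)
  Star-argCompatible {Q} Q-arg {f} ts i {u} steps =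
    subst (λ vs → Star Q (fun f vs) (fun f (ts [ i ]≔ u))) ([]≔-lookup ts i)
      (gmap (λ a → fun f (ts [ i ]≔ a)) lift steps)
    where
      lift : ∀ {a b} → Q a b → Q (fun f (ts [ i ]≔ a)) (fun f (ts [ i ]≔ b))
      lift {a} {b} q =
        subst (λ vs → Q (fun f (ts [ i ]≔ a)) (fun f vs)) ([]≔-idempotent ts i)
          (Q-arg (ts [ i ]≔ a) i (subst (λ z → Q z b) (sym (lookup∘update i ts a)) q))

module _ {A B : Set} (f : A → List B) where

  ∈-concatMap-take⁻ : ∀ (xs : List A) {n y} → y ∈ concatMap f (take n xs) →
    Σ (Fin (length xs)) λ m → toℕ m < n × y ∈ f (List.lookup xs m)
  ∈-concatMap-take⁻ (x ∷ xs) {suc n} p with ∈-++⁻ (f x) p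
  ... | inj₁ q = fzero , s≤s z≤n , q
  ... | inj₂ q with ∈-concatMap-take⁻ xs q
  ...   | m , m<n , r = fsuc m , s≤s m<n , r

  ∈-concatMap-take⁺ : ∀ (xs : List A) (m : Fin (length xs)) {n y} → toℕ m < n →
    y ∈ f (List.lookup xs m) → y ∈ concatMap f (take n xs)
  ∈-concatMap-take⁺ (x ∷ xs) fzero {suc n} _ p = ∈-++⁺ˡ p
  ∈-concatMap-take⁺ (x ∷ xs) (fsuc m) {suc n} (s≤s m<n) p =
    ∈-++⁺ʳ (f x) (∈-concatMap-take⁺ xs m m<n p)

  ∈-concatMap⁻-lookup : ∀ (xs : List A) {y} → y ∈ concatMap f xs →
    Σ (Fin (length xs)) λ m → y ∈ f (List.lookup xs m)
  ∈-concatMap⁻-lookup xs p = let q = ∈-concatMap⁻ f {xs} p in index q , lookup-index q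

toℕ-≤⇒<⊎≡ : ∀ {n} {m i : Fin n} → toℕ m ≤ toℕ i → toℕ m < toℕ i ⊎ m ≡ i
toℕ-≤⇒<⊎≡ m≤i with m≤n⇒m<n∨m≡n m≤i
... | inj₁ m<i = inj₁ m<i
... | inj₂ m≡i = inj₂ (toℕ-injective m≡i)

module _ {S : Signature} {I : Set} (R : I → CRule S) where

  StepN-mono : ∀ {m n} → m ≤ n → ∀ {s t} → StepN R m s t → StepN R n s t
  StepN-mono {zero} _ ()
  StepN-mono {suc m} (s≤s m≤n) =
    Cl-map λ { (mk α σ conds-hold) → mk α σ (All.map (Star.map (StepN-mono m≤n)) conds-hold) }

  infix 4 _↠_
  _↠_ : Term S → Term S → Set
  _↠_ = Star (StepR R)

  ConditionHolds : ∀ α → Subst S → Fin (k (R α)) → Set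
  ConditionHolds α ρ m = cs (R α) m ⟨ ρ ⟩ ↠ ct (R α) m ⟨ ρ ⟩

  StepR*⇒StepN* : ∀ {s t} → s ↠ t → Σ ℕ λ n → Star (StepN R n) s t
  StepR*⇒StepN* ε = 0 , ε
  StepR*⇒StepN* ((m , step) ◅ steps) with StepR*⇒StepN* steps
  ... | n , steps′ =
    m ⊔ n , (StepN-mono (m≤m⊔n m n) step ◅ Star.map (StepN-mono (m≤n⊔m m n)) steps′)

  StepR*⇒StepN*-All : ∀ (ρ : Subst S) (cl : List (Term S × Term S)) →
    (∀ m → proj₁ (List.lookup cl m) ⟨ ρ ⟩ ↠ proj₂ (List.lookup cl m) ⟨ ρ ⟩) →
    Σ ℕ λ n → All (λ c → Star (StepN R n) (proj₁ c ⟨ ρ ⟩) (proj₂ c ⟨ ρ ⟩)) cl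
  StepR*⇒StepN*-All ρ [] _ = 0 , []
  StepR*⇒StepN*-All ρ (c ∷ cl) holds
    with StepR*⇒StepN* (holds fzero) | StepR*⇒StepN*-All ρ cl (holds ∘ fsuc)
  ... | m , steps | n , rest =
    m ⊔ n , Star.map (StepN-mono (m≤m⊔n m n)) steps
          ∷ All.map (Star.map (StepN-mono (m≤n⊔m m n))) rest

  StepR-rule : ∀ α (ρ : Subst S) → (∀ m → ConditionHolds α ρ m) →
    StepR R (lhs (R α) ⟨ ρ ⟩) (rhs (R α) ⟨ ρ ⟩)
  StepR-rule α ρ holds with StepR*⇒StepN*-All ρ (conds (R α)) holds
  ... | n , holdsₙ = suc n , root (mk α ρ holdsₙ)

  StepR-argCompatible : ArgCompatible (StepR R)
  StepR-argCompatible ts i (suc n , step) = suc n , arg ts i step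

  private
    E : Signature
    E = ExtSig R

  mutual
    tb-emb-⟨⟩ : ∀ (t : Term S) (σ : Subst E) →
                tb R (emb R t ⟨ σ ⟩) ≡ t ⟨ tb R ∘ σ ⟩
    tb-emb-⟨⟩ (var x) σ = refl
    tb-emb-⟨⟩ (fun f ts) σ = cong (fun f) (tb*-emb*-⟨⟩ ts σ)

    tb*-emb*-⟨⟩ : ∀ {n} (ts : Vec (Term S) n) (σ : Subst E) →
                  tb* R (emb* R ts ⟨ σ ⟩*) ≡ ts ⟨ tb R ∘ σ ⟩*
    tb*-emb*-⟨⟩ [] σ = refl
    tb*-emb*-⟨⟩ (t ∷ ts) σ = cong₂ _∷_ (tb-emb-⟨⟩ t σ) (tb*-emb*-⟨⟩ ts σ)

  mutual
    tb-emb : ∀ (t : Term S) → tb R (emb R t) ≡ t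
    tb-emb (var x) = refl
    tb-emb (fun f ts) = cong (fun f) (tb*-emb* ts)

    tb*-emb* : ∀ {n} (ts : Vec (Term S) n) → tb* R (emb* R ts) ≡ ts
    tb*-emb* [] = refl
    tb*-emb* (t ∷ ts) = cong₂ _∷_ (tb-emb t) (tb*-emb* ts)

  mutual
    vars-emb : ∀ (t : Term S) → vars (emb R t) ≡ vars t
    vars-emb (var x) = refl
    vars-emb (fun f ts) = vars*-emb* ts

    vars*-emb* : ∀ {n} (ts : Vec (Term S) n) → vars* (emb* R ts) ≡ vars* ts
    vars*-emb* [] = refl
    vars*-emb* (t ∷ ts) = cong₂ _++_ (vars-emb t) (vars*-emb* ts)

  emb-nonvar : ∀ (t : Term S) → ¬ IsVar t → ¬ IsVar (emb R t)
  emb-nonvar (var x) nonvar _ = nonvar (x , refl)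
  emb-nonvar (fun f ts) _ (_ , ())

  vars*-varVec : ∀ xs → vars* (varVec R xs) ≡ xs
  vars*-varVec [] = refl
  vars*-varVec (x ∷ xs) = cong (x ∷_) (vars*-varVec xs)

  lookup-varVec : ∀ xs j → lookup (varVec R xs) j ≡ var (List.lookup xs j)
  lookup-varVec (x ∷ xs) fzero = refl
  lookup-varVec (x ∷ xs) (fsuc j) = lookup-varVec xs j

  lookup-tb* : ∀ {n} (ts : Vec (Term E) n) j → lookup (tb* R ts) j ≡ tb R (lookup ts j)
  lookup-tb* (t ∷ ts) fzero = refl
  lookup-tb* (t ∷ ts) (fsuc j) = lookup-tb* ts j

  tb*-[]≔ : ∀ {n} (ts : Vec (Term E) n) j u → tb* R (ts [ j ]≔ u) ≡ tb* R ts [ j ]≔ tb R u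
  tb*-[]≔ (t ∷ ts) fzero u = refl
  tb*-[]≔ (t ∷ ts) (fsuc j) u = cong (tb R t ∷_) (tb*-[]≔ ts j u)

  zipSubst-varVec : ∀ (xs : List ℕ) (σ : Subst E) {x} → x ∈ xs →
    zipSubst R xs (tb* R (varVec R xs ⟨ σ ⟩*)) x ≡ tb R (σ x)
  zipSubst-varVec (y ∷ xs) σ {x} p with y ≟ x | p
  ... | yes refl | _ = refl
  ... | no y≢x | here refl = ⊥-elim (y≢x refl)
  ... | no _ | there q = zipSubst-varVec xs σ q

  Xargs : ∀ α i → Subst E → Vec (Term E) (length (Xvec (R α) i))
  Xargs α i σ = varVec R (Xvec (R α) i) ⟨ σ ⟩*

  -- tb (U^α_i(w, vs)) is, by definition, lhs(α) ⟨ Xsubst α i vs ⟩.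
  Xsubst : ∀ α i → Vec (Term E) (length (Xvec (R α) i)) → Subst S
  Xsubst α i vs = zipSubst R (Xvec (R α) i) (tb* R vs)

  lookup-Xargs : ∀ α i σ j → lookup (Xargs α i σ) j ≡ σ (List.lookup (Xvec (R α) i) j)
  lookup-Xargs α i σ j =
    trans (lookup-⟨⟩* (varVec R (Xvec (R α) i)) σ j)
          (cong (_⟨ σ ⟩) (lookup-varVec (Xvec (R α) i) j))

  lookup-Xvec∈varsX : ∀ α i j → List.lookup (Xvec (R α) i) j ∈ varsX (R α) i
  lookup-Xvec∈varsX α i j = ∈-deduplicate⁻ _≟_ (varsX (R α) i) (∈-lookup j)

  ⟨Xsubst⟩-Xargs : ∀ α i σ (t : Term S) → (∀ {x} → x ∈ vars t → x ∈ varsX (R α) i) →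
    t ⟨ Xsubst α i (Xargs α i σ) ⟩ ≡ t ⟨ tb R ∘ σ ⟩
  ⟨Xsubst⟩-Xargs α i σ t t⊆X =
    ⟨⟩-cong t (λ x∈t → zipSubst-varVec (Xvec (R α) i) σ (∈-deduplicate⁺ _≟_ (t⊆X x∈t)))

  tb-Uterm : ∀ α i (w : Term E) σ →
             tb R (Uterm R α i w ⟨ σ ⟩) ≡ lhs (R α) ⟨ tb R ∘ σ ⟩
  tb-Uterm α i w σ = ⟨Xsubst⟩-Xargs α i σ (lhs (R α)) ∈-++⁺ˡ

  Us Ut : ∀ α → Fin (k (R α)) → Term E
  Us α i = Uterm R α i (emb R (cs (R α) i))
  Ut α i = Uterm R α i (emb R (ct (R α) i))

  module _ (α : I) where

    ∈-varsX⁻ : ∀ i {x} → x ∈ varsX (R α) i →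
      x ∈ vars (lhs (R α)) ⊎ Σ (Fin (k (R α))) λ m → toℕ m < toℕ i × x ∈ vars (ct (R α) m)
    ∈-varsX⁻ i p with ∈-++⁻ (vars (lhs (R α))) p
    ... | inj₁ q = inj₁ q
    ... | inj₂ q = inj₂ (∈-concatMap-take⁻ (vars ∘ proj₂) (conds (R α)) q)

    ∈-varsX⁺ : ∀ {m i} → toℕ m < toℕ i →
               ∀ {x} → x ∈ vars (ct (R α) m) → x ∈ varsX (R α) i
    ∈-varsX⁺ {m} m<i p =
      ∈-++⁺ʳ (vars (lhs (R α))) (∈-concatMap-take⁺ (vars ∘ proj₂) (conds (R α)) m m<i p)

    varsX-mono : ∀ {m i} → toℕ m ≤ toℕ i →
                 ∀ {x} → x ∈ varsX (R α) m → x ∈ varsX (R α) i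
    varsX-mono m≤i p with ∈-varsX⁻ _ p
    ... | inj₁ q = ∈-++⁺ˡ q
    ... | inj₂ (m′ , m′<m , q) = ∈-varsX⁺ (<-≤-trans m′<m m≤i) q

    varsX-zero : ∀ i → toℕ i ≡ 0 → ∀ {x} → x ∈ varsX (R α) i → x ∈ vars (lhs (R α))
    varsX-zero i i≡0 p with ∈-varsX⁻ i p
    ... | inj₁ q = q
    ... | inj₂ (m , m<i , _) = ⊥-elim (n≮0 (subst (toℕ m <_) i≡0 m<i))

    varsX-suc : ∀ i j → toℕ j ≡ suc (toℕ i) → ∀ {x} → x ∈ varsX (R α) j →
      x ∈ varsX (R α) i ⊎ x ∈ vars (ct (R α) i)
    varsX-suc i j j≡1+i p with ∈-varsX⁻ j p
    ... | inj₁ q = inj₁ (∈-++⁺ˡ q)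
    ... | inj₂ (m , m<j , q) with toℕ-≤⇒<⊎≡ (≤-pred (subst (toℕ m <_) j≡1+i m<j))
    ...   | inj₁ m<i = inj₁ (∈-varsX⁺ m<i q)
    ...   | inj₂ refl = inj₂ q

  mutual
    record ValidU (α : I) (i : Fin (k (R α))) (w : Term E)
                  (vs : Vec (Term E) (length (Xvec (R α) i))) : Set where
      inductive
      field
        valid-arg          : Valid w
        args-redexFree     : ∀ j → RedexFree (Useq R) (lookup vs j)
        earlier-conditions : ∀ m → toℕ m < toℕ i → ConditionHolds α (Xsubst α i vs) m
        current-condition  : cs (R α) i ⟨ Xsubst α i vs ⟩ ↠ tb R w

    data Valid : Term E → Set where
      -- covers U-terms stuck on a failing condition: they never step.
      valid-redexFree : ∀ {t} → RedexFree (Useq R) t → Valid t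
      valid-var       : ∀ {x} → Valid (var x)
      valid-fun       : ∀ {f ts} → (∀ j → Valid (lookup ts j)) → Valid (fun (inj₁ f) ts)
      valid-U         : ∀ {α i w vs} → ValidU α i w vs → Valid (fun (inj₂ (α , i)) (w ∷ vs))

  open ValidU

  mutual
    valid-emb : ∀ (t : Term S) → Valid (emb R t)
    valid-emb (var x) = valid-var
    valid-emb (fun f ts) = valid-fun (valid-emb* ts)

    valid-emb* : ∀ {n} (ts : Vec (Term S) n) j → Valid (lookup (emb* R ts) j)
    valid-emb* (t ∷ ts) fzero = valid-emb t
    valid-emb* (t ∷ ts) (fsuc j) = valid-emb* ts j

  mutual
    valid-emb-⟨⟩ : ∀ (t : Term S) σ →
                   (∀ {x} → x ∈ vars t → Valid (σ x)) → Valid (emb R t ⟨ σ ⟩)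
    valid-emb-⟨⟩ (var x) σ valid = valid (here refl)
    valid-emb-⟨⟩ (fun f ts) σ valid = valid-fun (valid-emb*-⟨⟩ ts σ valid)

    valid-emb*-⟨⟩ : ∀ {n} (ts : Vec (Term S) n) σ →
                    (∀ {x} → x ∈ vars* ts → Valid (σ x)) → ∀ j → Valid (lookup (emb* R ts ⟨ σ ⟩*) j)
    valid-emb*-⟨⟩ (t ∷ ts) σ valid fzero = valid-emb-⟨⟩ t σ (valid ∘ ∈-++⁺ˡ)
    valid-emb*-⟨⟩ (t ∷ ts) σ valid (fsuc j) =
      valid-emb*-⟨⟩ ts σ (valid ∘ ∈-++⁺ʳ (vars t)) j

  valid-[]≔ : ∀ {n} (ts : Vec (Term E) n) i {u} →
    (∀ j → Valid (lookup ts j)) → Valid u → ∀ j → Valid (lookup (ts [ i ]≔ u) j)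
  valid-[]≔ ts i {u} valid-ts valid-u j with j Fin.≟ i
  ... | yes refl = subst Valid (sym (lookup∘update j ts u)) valid-u
  ... | no j≢i = subst Valid (sym (lookup∘update′ j≢i ts u)) (valid-ts j)

  ValidU-redex : ∀ {α i w vs} → Valid (fun (inj₂ (α , i)) (w ∷ vs)) →
    Redex (Useq R) (fun (inj₂ (α , i)) (w ∷ vs)) → ValidU α i w vs
  ValidU-redex (valid-redexFree free) redex = ⊥-elim (free _ (inj₁ refl) redex)
  ValidU-redex (valid-U valid) _ = valid

  Tracks : Term E → Term E → Set
  Tracks t t′ = tb R t ↠ tb R t′ × Valid t′

  Ut-bindings-redexFree : ∀ α i σ → ProperSubtermsRedexFree (Useq R) (Ut α i ⟨ σ ⟩) →
    ∀ {x} → x ∈ varsX (R α) i ⊎ x ∈ vars (ct (R α) i) → RedexFree (Useq R) (σ x)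
  Ut-bindings-redexFree α i σ inner {x} p =
    bindings-redexFree (Ut α i) σ (λ { (_ , ()) }) inner (x∈Ut p)
    where
      x∈Ut : x ∈ varsX (R α) i ⊎ x ∈ vars (ct (R α) i) → x ∈ vars (Ut α i)
      x∈Ut (inj₁ q) = ∈-++⁺ʳ (vars (emb R (ct (R α) i)))
                        (subst (x ∈_) (sym (vars*-varVec (Xvec (R α) i))) (∈-deduplicate⁺ _≟_ q))
      x∈Ut (inj₂ q) = ∈-++⁺ˡ (subst (x ∈_) (sym (vars-emb (ct (R α) i))) q)

  module _ (det : IsDCTRS R) where

    cs-vars : ∀ α i {x} → x ∈ vars (cs (R α) i) → x ∈ varsX (R α) i
    cs-vars α i = proj₂ (proj₂ (det α)) i

    cs-vars-≤ : ∀ α {m i} → toℕ m ≤ toℕ i →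
                ∀ {x} → x ∈ vars (cs (R α) m) → x ∈ varsX (R α) i
    cs-vars-≤ α m≤i p = varsX-mono α m≤i (cs-vars α _ p)

    rhs-vars : ∀ α {x} → x ∈ vars (rhs (R α)) →
      x ∈ vars (lhs (R α)) ⊎ Σ (Fin (k (R α))) λ m → x ∈ vars (cs (R α) m) ++ vars (ct (R α) m)
    rhs-vars α p with ∈-++⁻ (vars (lhs (R α))) (proj₁ (proj₂ (det α)) p)
    ... | inj₁ q = inj₁ q
    ... | inj₂ q = inj₂ (∈-concatMap⁻-lookup _ (conds (R α)) q)

    ≤-last : ∀ {α} {i : Fin (k (R α))} → suc (toℕ i) ≡ k (R α) →
             ∀ (m : Fin (k (R α))) → toℕ m ≤ toℕ i
    ≤-last last m = ≤-pred (subst (toℕ m <_) (sym last) (toℕ<n m))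

    rhs-vars-last : ∀ α i → suc (toℕ i) ≡ k (R α) → ∀ {x} → x ∈ vars (rhs (R α)) →
      x ∈ varsX (R α) i ⊎ x ∈ vars (ct (R α) i)
    rhs-vars-last α i last p with rhs-vars α p
    ... | inj₁ q = inj₁ (∈-++⁺ˡ q)
    ... | inj₂ (m , q) with ∈-++⁻ (vars (cs (R α) m)) q
    ...   | inj₁ r = inj₁ (cs-vars-≤ α (≤-last last m) r)
    ...   | inj₂ r with toℕ-≤⇒<⊎≡ (≤-last last m)
    ...     | inj₁ m<i = inj₁ (∈-varsX⁺ α m<i r)
    ...     | inj₂ refl = inj₂ r

    lhs-bindings-redexFree : ∀ α σ →
      ProperSubtermsRedexFree (Useq R) (emb R (lhs (R α)) ⟨ σ ⟩) →
      ∀ {x} → x ∈ vars (lhs (R α)) → RedexFree (Useq R) (σ x)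
    lhs-bindings-redexFree α σ inner {x} p =
      bindings-redexFree (emb R (lhs (R α))) σ (emb-nonvar _ (proj₁ (det α))) inner
        (subst (x ∈_) (sym (vars-emb (lhs (R α)))) p)

    valid-Us : ∀ α j σ → (∀ {x} → x ∈ varsX (R α) j → RedexFree (Useq R) (σ x)) →
      (∀ m → toℕ m < toℕ j → ConditionHolds α (tb R ∘ σ) m) → Valid (Us α j ⟨ σ ⟩)
    valid-Us α j σ free holds = valid-U record
      { valid-arg          = valid-emb-⟨⟩ (cs (R α) j) σ
                               (λ p → valid-redexFree (free (cs-vars α j p)))
      ; args-redexFree     = λ j′ → subst (RedexFree (Useq R)) (sym (lookup-Xargs α j σ j′))
                                      (free (lookup-Xvec∈varsX α j j′))
      ; earlier-conditions = λ m m<j → subst₂ _↠_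
                               (sym (⟨Xsubst⟩-Xargs α j σ (cs (R α) m) (cs-vars-≤ α (<⇒≤ m<j))))
                               (sym (⟨Xsubst⟩-Xargs α j σ (ct (R α) m) (∈-varsX⁺ α m<j)))
                               (holds m m<j)
      ; current-condition  = reflexive (StepR R)
                               (trans (⟨Xsubst⟩-Xargs α j σ (cs (R α) j) (cs-vars α j))
                                      (sym (tb-emb-⟨⟩ (cs (R α) j) σ)))
      }

    passed-conditions : ∀ α i σ → ValidU α i (emb R (ct (R α) i) ⟨ σ ⟩) (Xargs α i σ) →
      ∀ m → toℕ m ≤ toℕ i → ConditionHolds α (tb R ∘ σ) m
    passed-conditions α i σ valid m m≤i with toℕ-≤⇒<⊎≡ m≤i
    ... | inj₁ m<i = subst₂ _↠_
                       (⟨Xsubst⟩-Xargs α i σ (cs (R α) m) (cs-vars-≤ α m≤i))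
                       (⟨Xsubst⟩-Xargs α i σ (ct (R α) m) (∈-varsX⁺ α m<i))
                       (earlier-conditions valid m m<i)
    ... | inj₂ refl = subst₂ _↠_
                        (⟨Xsubst⟩-Xargs α i σ (cs (R α) i) (cs-vars α i))
                        (tb-emb-⟨⟩ (ct (R α) i) σ)
                        (current-condition valid)

    innerRoot-tracks : ∀ {t t′} → Valid t → InnerRoot (Useq R) t t′ → Tracks t t′
    innerRoot-tracks _ (mk σ (uncond α noConds) inner) =
      subst₂ _↠_ (sym (tb-emb-⟨⟩ (lhs (R α)) σ)) (sym (tb-emb-⟨⟩ (rhs (R α)) σ))
        (Star.return (StepR-rule α (tb R ∘ σ) (⊥-elim ∘ noCondition)))
      , valid-emb-⟨⟩ (rhs (R α)) σ rhs-valid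
      where
        noCondition : ¬ Fin (k (R α))
        noCondition m = ¬Fin0 (subst (Fin ∘ length) noConds m)
        rhs-valid : ∀ {x} → x ∈ vars (rhs (R α)) → Valid (σ x)
        rhs-valid p with rhs-vars α p
        ... | inj₁ q = valid-redexFree (lhs-bindings-redexFree α σ inner q)
        ... | inj₂ (m , _) = ⊥-elim (noCondition m)
    innerRoot-tracks _ (mk σ (first α i i≡0) inner) =
      reflexive (StepR R) (trans (tb-emb-⟨⟩ (lhs (R α)) σ)
                                 (sym (tb-Uterm α i (emb R (cs (R α) i)) σ)))
      , valid-Us α i σ (λ p → lhs-bindings-redexFree α σ inner (varsX-zero α i i≡0 p))
                       (λ m m<i → ⊥-elim (n≮0 (subst (toℕ m <_) i≡0 m<i)))
    innerRoot-tracks v (mk σ (middle α i j j≡1+i) inner) =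
      reflexive (StepR R) (trans (tb-Uterm α i (emb R (ct (R α) i)) σ)
                                 (sym (tb-Uterm α j (emb R (cs (R α) j)) σ)))
      , valid-Us α j σ (λ p → Ut-bindings-redexFree α i σ inner (varsX-suc α i j j≡1+i p))
                       (λ m m<j → passed-conditions α i σ valid m
                                    (≤-pred (subst (toℕ m <_) j≡1+i m<j)))
      where
        valid = ValidU-redex v (_ , _ , σ , middle α i j j≡1+i , refl)
    innerRoot-tracks v (mk σ (final α i last) inner) =
      subst₂ _↠_ (sym (tb-Uterm α i (emb R (ct (R α) i)) σ)) (sym (tb-emb-⟨⟩ (rhs (R α)) σ))
        (Star.return (StepR-rule α (tb R ∘ σ)
                       (λ m → passed-conditions α i σ valid m (≤-last last m))))
      , valid-emb-⟨⟩ (rhs (R α)) σ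
          (λ p → valid-redexFree (Ut-bindings-redexFree α i σ inner (rhs-vars-last α i last p)))
      where
        valid = ValidU-redex v (_ , _ , σ , final α i last , refl)

    innermostStep-tracks : ∀ {t t′} → Valid t → InnermostStep (Useq R) t t′ → Tracks t t′
    innermostStep-tracks v (root step) = innerRoot-tracks v step
    innermostStep-tracks (valid-redexFree free) step = ⊥-elim (RedexFree⇒¬InnermostStep free step)
    innermostStep-tracks (valid-fun {f} valid) (arg ts i {u} step)
      with innermostStep-tracks (valid i) step
    ... | steps , valid-u =
      subst (λ vs → fun f (tb* R ts) ↠ fun f vs) (sym (tb*-[]≔ ts i u))
        (Star-argCompatible StepR-argCompatible (tb* R ts) i
          (subst (_↠ tb R u) (sym (lookup-tb* ts i)) steps))
      , valid-fun (valid-[]≔ ts i valid valid-u)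
    innermostStep-tracks (valid-U valid) (arg (w ∷ vs) fzero step)
      with innermostStep-tracks (valid-arg valid) step
    ... | steps , valid-w′ =
      ε , valid-U record
            { valid-arg          = valid-w′
            ; args-redexFree     = args-redexFree valid
            ; earlier-conditions = earlier-conditions valid
            ; current-condition  = current-condition valid ◅◅ steps
            }
    innermostStep-tracks (valid-U valid) (arg (w ∷ vs) (fsuc j) step) =
      ⊥-elim (RedexFree⇒¬InnermostStep (args-redexFree valid j) step)

    innermost-tracks : ∀ {t v} → Valid t → Star (InnermostStep (Useq R)) t v → tb R t ↠ tb R v
    innermost-tracks _ ε = ε
    innermost-tracks valid (step ◅ steps) with innermostStep-tracks valid step
    ... | tb-steps , valid′ = tb-steps ◅◅ innermost-tracks valid′ steps

theorem14 : {S : Signature} {I : Set} (R : I → CRule S) →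
    IsDCTRS R → RightStable R →
    (u : Term S) (v : Term (ExtSig R)) →
    Star (InnermostStep (Useq R)) (emb R u) v →
    Star (StepR R) u (tb R v)
theorem14 R det _ u v steps =
  subst (λ s → Star (StepR R) s (tb R v)) (tb-emb R u) (innermost-tracks R det (valid-emb R u) steps)
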